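{- Let $n$ be a positive integer. The only element of $\mathcal H(n)$ with no ancestors is the expansion $\vec n'$ containing no digit $0$. The only element of $\mathcal H(n)$ with no descendants is the binary expansion $\vec n''$ of $n$.
   Context: A hyperbinary expansion of a positive integer $n$ is a word $x_1\cdots x_k$ over $\{0,1,2\}$ with $x_1\neq 0$ and $n=\sum_{i=1}^k x_i2^{k-i}$; $\mathcal H(n)$ is the set of these. There is a unique element $\vec n'\in\mathcal H(n)$ with no digit $0$; the binary expansion $\vec n''$ is the unique element with digits in $\{0,1\}$. Words are regarded up to leading zeros. Single-step reductions are: (I) $2\vec y \to 1\,0\,\vec y$; (II) $\vec x\,0\,2\,\vec y\to \vec x\,1\,0\,\vec y$; (III) $\vec x\,1\,2\,\vec y \twoheadrightarrow \vec x\,2\,0\,\vec y$, for words $\vec x,\vec y$ over $\{0,1,2\}$. $\vec u$ is an ancestor of $\vec v$ (and $\vec v$ a descendant of $\vec u$) if $\vec v$ is obtained from $\vec u$ by a finite positive number of single-step reductions. -}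

module Defs where

open import Data.Nat using (ℕ; zero; suc; _+_; _*_)
open import Data.List using (List; []; _∷_; _++_; foldl)
open import Data.List.Relation.Unary.All using (All)
open import Data.Product using (Σ; _×_; ∃)
open import Relation.Nullary using (¬_)
open import Relation.Binary.PropositionalEquality using (_≡_)
open import Relation.Binary.Construct.Closure.Transitive using (TransClosure)

data Digit : Set where
  d0 d1 d2 : Digit

digitVal : Digit → ℕ
digitVal d0 = 0
digitVal d1 = 1
digitVal d2 = 2

-- words over {0,1,2}, most significant digit first
Word : Set
Word = List Digit

value : Word → ℕ
value = foldl (λ acc d → 2 * acc + digitVal d) 0

-- first digit nonzero (canonical representative up to leading zeros)
LeadingNonzero : Word → Set
LeadingNonzero []       = Data.Empty.⊥ where import Data.Empty
LeadingNonzero (d0 ∷ _) = Data.Empty.⊥ where import Data.Empty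
LeadingNonzero (d1 ∷ _) = Data.Unit.⊤ where import Data.Unit
LeadingNonzero (d2 ∷ _) = Data.Unit.⊤ where import Data.Unit

IsHyperbinary : ℕ → Word → Set
IsHyperbinary n w = LeadingNonzero w × value w ≡ n

data Step : Word → Word → Set where
  stepI   : ∀ y     → Step (d2 ∷ y) (d1 ∷ d0 ∷ y)
  stepII  : ∀ x y   → Step (x ++ d0 ∷ d2 ∷ y) (x ++ d1 ∷ d0 ∷ y)
  stepIII : ∀ x y   → Step (x ++ d1 ∷ d2 ∷ y) (x ++ d2 ∷ d0 ∷ y)

Reduces⁺ : Word → Word → Set
Reduces⁺ = TransClosure Step

-- u is an ancestor of v (ancestors taken as words with nonzero first digit,
-- i.e. canonical representatives modulo leading zeros)
IsAncestor : Word → Word → Set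
IsAncestor u v = LeadingNonzero u × Reduces⁺ u v

IsDescendant : Word → Word → Set
IsDescendant v u = Reduces⁺ u v

HasNoAncestors : Word → Set
HasNoAncestors v = ¬ (∃ λ u → IsAncestor u v)

HasNoDescendants : Word → Set
HasNoDescendants u = ¬ (∃ λ v → IsDescendant v u)

NonzeroDigit : Digit → Set
NonzeroDigit d = ¬ (d ≡ d0)

BinaryDigit : Digit → Set
BinaryDigit d = ¬ (d ≡ d2)

IsNoZeroExpansion : Word → Set
IsNoZeroExpansion = All NonzeroDigit

IsBinaryExpansion : Word → Set
IsBinaryExpansion = All BinaryDigit

-- A reduction step always writes a digit 0 and always consumes a digit 2, so a
-- word without 0 has no ancestor and a binary word has no descendant.
-- Conversely, a word with a 0 whose first digit is nonzero has a nonzero digit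
-- c directly followed by 0, and "c 0" is the result of rule I or II (c = 1) or
-- of rule III (c = 2); a word with a 2 either starts with 2 (rule I applies) or
-- has a digit c ≠ 2 directly followed by 2 (rule II or III applies).
module Submission where

open import Defs
open import Data.Nat using (ℕ; _<_)
open import Data.Product using (_×_; _,_; ∃)
open import Function.Bundles using (_⇔_; mk⇔)
open import Data.List using (List; []; _∷_; _++_)
open import Data.List.Relation.Unary.All using (All; []; _∷_)
open import Data.List.Relation.Unary.All.Properties using (++⁻ʳ)
open import Data.Empty using (⊥-elim)
open import Data.Unit using (tt)
open import Relation.Nullary using (¬_; yes; no)
open import Relation.Binary.Definitions using (DecidableEquality)
open import Relation.Binary.PropositionalEquality using (_≢_; refl)
open import Relation.Binary.Construct.Closure.Transitive using ([_]; _∷_)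

_≟_ : DecidableEquality Digit
d0 ≟ d0 = yes refl
d0 ≟ d1 = no λ ()
d0 ≟ d2 = no λ ()
d1 ≟ d0 = no λ ()
d1 ≟ d1 = yes refl
d1 ≟ d2 = no λ ()
d2 ≟ d0 = no λ ()
d2 ≟ d1 = no λ ()
d2 ≟ d2 = yes refl

module _ {A : Set} (_≟ᴬ_ : DecidableEquality A) (b : A) where

  data OccurrenceView : List A → Set where
    avoids  : ∀ {w} → All (_≢ b) w → OccurrenceView w
    leading : ∀ y → OccurrenceView (b ∷ y)
    after   : ∀ x {c} y → c ≢ b → OccurrenceView (x ++ c ∷ b ∷ y)

  occurrenceView : (w : List A) → OccurrenceView w
  occurrenceView [] = avoids []
  occurrenceView (a ∷ w) with a ≟ᴬ b
  ... | yes refl = leading w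
  ... | no a≢b with occurrenceView w
  ...   | avoids w≢b     = avoids (a≢b ∷ w≢b)
  ...   | leading y      = after [] y a≢b
  ...   | after x y c≢b = after (a ∷ x) y c≢b

Step-target-has-0 : ∀ {v w} → Step v w → ¬ IsNoZeroExpansion w
Step-target-has-0 (stepI y) (_ ∷ 0≢0 ∷ _) = 0≢0 refl
Step-target-has-0 (stepII x y) w≢0 with ++⁻ʳ x w≢0
... | _ ∷ 0≢0 ∷ _ = 0≢0 refl
Step-target-has-0 (stepIII x y) w≢0 with ++⁻ʳ x w≢0
... | _ ∷ 0≢0 ∷ _ = 0≢0 refl

Step-source-has-2 : ∀ {v w} → Step v w → ¬ IsBinaryExpansion v
Step-source-has-2 (stepI y) (2≢2 ∷ _) = 2≢2 refl
Step-source-has-2 (stepII x y) v≢2 with ++⁻ʳ x v≢2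
... | _ ∷ 2≢2 ∷ _ = 2≢2 refl
Step-source-has-2 (stepIII x y) v≢2 with ++⁻ʳ x v≢2
... | _ ∷ 2≢2 ∷ _ = 2≢2 refl

Reduces⁺-lastStep : ∀ {u w} → Reduces⁺ u w → ∃ λ v → Step v w
Reduces⁺-lastStep [ s ]   = _ , s
Reduces⁺-lastStep (_ ∷ r) = Reduces⁺-lastStep r

Reduces⁺-firstStep : ∀ {u w} → Reduces⁺ u w → ∃ λ v → Step u v
Reduces⁺-firstStep [ s ]   = _ , s
Reduces⁺-firstStep (s ∷ _) = _ , s

leadingNonzero-∷ : ∀ a {s t} → LeadingNonzero (a ∷ s) → LeadingNonzero (a ∷ t)
leadingNonzero-∷ d1 _ = tt
leadingNonzero-∷ d2 _ = tt

nonzero-before-0⇒ancestor : ∀ x {c} y → c ≢ d0 → LeadingNonzero (x ++ c ∷ d0 ∷ y) →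
                            ∃ λ u → IsAncestor u (x ++ c ∷ d0 ∷ y)
nonzero-before-0⇒ancestor x {d0} y c≢0 _ = ⊥-elim (c≢0 refl)
nonzero-before-0⇒ancestor [] {d1} y _ _ = d2 ∷ y , tt , [ stepI y ]
nonzero-before-0⇒ancestor [] {d2} y _ _ = d1 ∷ d2 ∷ y , tt , [ stepIII [] y ]
nonzero-before-0⇒ancestor (a ∷ x) {d1} y _ ln =
  (a ∷ x) ++ d0 ∷ d2 ∷ y , leadingNonzero-∷ a ln , [ stepII (a ∷ x) y ]
nonzero-before-0⇒ancestor (a ∷ x) {d2} y _ ln =
  (a ∷ x) ++ d1 ∷ d2 ∷ y , leadingNonzero-∷ a ln , [ stepIII (a ∷ x) y ]

non2-before-2⇒descendant : ∀ x {c} y → c ≢ d2 → ∃ λ v → IsDescendant v (x ++ c ∷ d2 ∷ y)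
non2-before-2⇒descendant x {d0} y _ = _ , [ stepII x y ]
non2-before-2⇒descendant x {d1} y _ = _ , [ stepIII x y ]
non2-before-2⇒descendant x {d2} y c≢2 = ⊥-elim (c≢2 refl)

noZero⇒noAncestors : ∀ {w} → IsNoZeroExpansion w → HasNoAncestors w
noZero⇒noAncestors w≢0 (_ , _ , r) with Reduces⁺-lastStep r
... | _ , s = Step-target-has-0 s w≢0

noAncestors⇒noZero : ∀ w → LeadingNonzero w → HasNoAncestors w → IsNoZeroExpansion w
noAncestors⇒noZero w ln noAnc with occurrenceView _≟_ d0 w
... | avoids w≢0    = w≢0
... | leading _     = ⊥-elim ln
... | after x y c≢0 = ⊥-elim (noAnc (nonzero-before-0⇒ancestor x y c≢0 ln))

binary⇒noDescendants : ∀ {w} → IsBinaryExpansion w → HasNoDescendants w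
binary⇒noDescendants w≢2 (_ , r) with Reduces⁺-firstStep r
... | _ , s = Step-source-has-2 s w≢2

noDescendants⇒binary : ∀ w → HasNoDescendants w → IsBinaryExpansion w
noDescendants⇒binary w noDesc with occurrenceView _≟_ d2 w
... | avoids w≢2    = w≢2
... | leading y     = ⊥-elim (noDesc (_ , [ stepI y ]))
... | after x y c≢2 = ⊥-elim (noDesc (non2-before-2⇒descendant x y c≢2))

proposition2p5 : (n : ℕ) → 0 < n → (w : Word) → IsHyperbinary n w →
    (HasNoAncestors w ⇔ IsNoZeroExpansion w) × (HasNoDescendants w ⇔ IsBinaryExpansion w)
proposition2p5 _ _ w (ln , _) =
  mk⇔ (noAncestors⇒noZero w ln) noZero⇒noAncestors ,
  mk⇔ (noDescendants⇒binary w) binary⇒noDescendants
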